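{- Let $\mathsf V$ be any variety of FL${}_{\mathrm e}$-algebras with $\mathsf{HA}\subseteq\mathsf V\subseteq\mathbf G_{\mathsf{FL}_{\mathsf e}}(\mathsf{BA})$. Then $(\mathsf V,\Rightarrow_{\wedge})$ and $(\mathsf V,\Rightarrow_{\circ})$ are both connexive.
   Context: An FL${}_{\mathrm e}$-algebra is an algebra $\langle A,\wedge,\vee,\cdot,\to,0,1\rangle$ such that $\langle A,\wedge,\vee\rangle$ is a lattice (with order $\leq$), $\langle A,\cdot,1\rangle$ is a commutative monoid, $0$ is an arbitrary constant, and $x\cdot y\leq z\iff x\leq y\to z$. Write $\neg x:=x\to 0$, $x\Rightarrow_{\wedge} y:=(x\to y)\wedge(y\to\neg\neg x)$ and $x\Rightarrow_{\circ} y:=(x\to y)\cdot(y\to\neg\neg x)$. For a binary term operation ${\Rightarrow}$ and a variety $\mathsf V$: $(\mathsf V,{\Rightarrow})$ is proto-connexive if every member satisfies, for all $x,y$, $1\leq\neg(x{\Rightarrow}\neg x)$, $1\leq\neg(\neg x{\Rightarrow} x)$, $1\leq (x{\Rightarrow} y){\Rightarrow}\neg(x{\Rightarrow}\neg y)$, $1\leq (x{\Rightarrow}\neg y){\Rightarrow}\neg(x{\Rightarrow} y)$; it is connexive if moreover some member of $\mathsf V$ has elements $x,y$ with $x{\Rightarrow} y\neq y{\Rightarrow} x$. $\mathsf{HA}$ is the variety of Heyting algebras, i.e. FL${}_{\mathrm e}$-algebras with $1$ greatest, $0$ least, and $\cdot=\wedge$. $\mathsf{BA}$ is the variety of Boolean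 algebras viewed as FL${}_{\mathrm e}$-algebras satisfying $x\cdot y=x\wedge y$ and $x\to y=\neg x\vee y$; $\mathbf G_{\mathsf{FL}_{\mathsf e}}(\mathsf{BA})$ is the largest variety $\mathsf W$ of FL${}_{\mathrm e}$-algebras such that for every equation $s\approx t$, $\mathsf{BA}\models s\approx t$ iff $\mathsf W\models\neg s\approx\neg t$. -}

module Defs where

open import Level using (Level; suc; _⊔_)
open import Data.Nat using (ℕ)
open import Data.Product using (Σ; ∃; _×_; _,_)
open import Function.Bundles using (_⇔_)
open import Relation.Binary.PropositionalEquality using (_≡_; _≢_)

record FLe (c : Level) : Set (suc c) where
  infixr 5 _↝_
  infixr 6 _∨_
  infixr 7 _∧_
  infixr 8 _·_
  infix 4 _≤_
  infix 9 ¬_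
  field
    Carrier : Set c
    _∧_ _∨_ _·_ _↝_ : Carrier → Carrier → Carrier
    𝟘 𝟙 : Carrier
    ∧-comm   : ∀ x y → x ∧ y ≡ y ∧ x
    ∨-comm   : ∀ x y → x ∨ y ≡ y ∨ x
    ∧-assoc  : ∀ x y z → (x ∧ y) ∧ z ≡ x ∧ (y ∧ z)
    ∨-assoc  : ∀ x y z → (x ∨ y) ∨ z ≡ x ∨ (y ∨ z)
    ∧-absorbs-∨ : ∀ x y → x ∧ (x ∨ y) ≡ x
    ∨-absorbs-∧ : ∀ x y → x ∨ (x ∧ y) ≡ x
    ·-comm   : ∀ x y → x · y ≡ y · x
    ·-assoc  : ∀ x y z → (x · y) · z ≡ x · (y · z)
    ·-identityˡ : ∀ x → 𝟙 · x ≡ x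

  _≤_ : Carrier → Carrier → Set c
  x ≤ y = x ∧ y ≡ x

  field
    residuated : ∀ x y z → (x · y ≤ z) ⇔ (x ≤ y ↝ z)

  ¬_ : Carrier → Carrier
  ¬ x = x ↝ 𝟘

  _⇒∧_ : Carrier → Carrier → Carrier
  x ⇒∧ y = (x ↝ y) ∧ (y ↝ ¬ (¬ x))

  _⇒∘_ : Carrier → Carrier → Carrier
  x ⇒∘ y = (x ↝ y) · (y ↝ ¬ (¬ x))

data Term : Set where
  var : ℕ → Term
  _∧ₜ_ _∨ₜ_ _·ₜ_ _↝ₜ_ : Term → Term → Term
  0ₜ 1ₜ : Term

¬ₜ_ : Term → Term
¬ₜ s = s ↝ₜ 0ₜ

Equation : Set
Equation = Term × Term

module _ {c : Level} (A : FLe c) where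
  open FLe A
  ⟦_⟧ : Term → (ℕ → Carrier) → Carrier
  ⟦ var i ⟧ ρ = ρ i
  ⟦ s ∧ₜ t ⟧ ρ = ⟦ s ⟧ ρ ∧ ⟦ t ⟧ ρ
  ⟦ s ∨ₜ t ⟧ ρ = ⟦ s ⟧ ρ ∨ ⟦ t ⟧ ρ
  ⟦ s ·ₜ t ⟧ ρ = ⟦ s ⟧ ρ · ⟦ t ⟧ ρ
  ⟦ s ↝ₜ t ⟧ ρ = ⟦ s ⟧ ρ ↝ ⟦ t ⟧ ρ
  ⟦ 0ₜ ⟧ ρ = 𝟘
  ⟦ 1ₜ ⟧ ρ = 𝟙

_⊨_ : ∀ {c} → FLe c → Equation → Set c
A ⊨ (s , t) = ∀ (ρ : ℕ → FLe.Carrier A) → ⟦ A ⟧ s ρ ≡ ⟦ A ⟧ t ρ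

Class : (c : Level) → Set (suc c)
Class c = FLe c → Set c

_⊆_ : ∀ {c} → Class c → Class c → Set (suc c)
K ⊆ L = ∀ A → K A → L A

_⊨ᶜ_ : ∀ {c} → Class c → Equation → Set (suc c)
K ⊨ᶜ e = ∀ A → K A → A ⊨ e

Mod : ∀ {c} → (Equation → Set) → Class c
Mod E A = ∀ e → E e → A ⊨ e

IsVariety : ∀ {c} → Class c → Set (suc c)
IsVariety K = Σ (Equation → Set) λ E → ∀ A → K A ⇔ Mod E A

IsHA : ∀ {c} → Class c
IsHA A = (∀ x → x ≤ 𝟙) × (∀ x → 𝟘 ≤ x) × (∀ x y → x · y ≡ x ∧ y)
  where open FLe A

IsBA : ∀ {c} → Class c
IsBA A = (∀ x → x ≤ 𝟙) × (∀ x → 𝟘 ≤ x)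
       × (∀ x y z → x ∧ (y ∨ z) ≡ (x ∧ y) ∨ (x ∧ z))
       × (∀ x → x ∧ ¬ x ≡ 𝟘) × (∀ x → x ∨ ¬ x ≡ 𝟙)
       × (∀ x y → x · y ≡ x ∧ y) × (∀ x y → x ↝ y ≡ ¬ x ∨ y)
  where open FLe A

GlivenkoBA : ∀ {c} → Class c → Set (suc c)
GlivenkoBA {c} W = ∀ s t → (IsBA {c} ⊨ᶜ (s , t)) ⇔ (W ⊨ᶜ (¬ₜ s , ¬ₜ t))

IsGlivenkoVarietyBA : ∀ {c} → Class c → Set (suc c)
IsGlivenkoVarietyBA {c} G =
  IsVariety G × GlivenkoBA G
  × (∀ (W : Class c) → IsVariety W → GlivenkoBA W → W ⊆ G)

BinOp : (c : Level) → Set (suc c)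
BinOp c = (A : FLe c) → FLe.Carrier A → FLe.Carrier A → FLe.Carrier A

ProtoConnexive : ∀ {c} → Class c → BinOp c → Set (suc c)
ProtoConnexive V op = ∀ A → V A →
  let open FLe A
      infixr 5 _⇒_
      _⇒_ = op A
  in ∀ x y →
       (𝟙 ≤ ¬ (x ⇒ ¬ x))
     × (𝟙 ≤ ¬ (¬ x ⇒ x))
     × (𝟙 ≤ ((x ⇒ y) ⇒ ¬ (x ⇒ ¬ y)))
     × (𝟙 ≤ ((x ⇒ ¬ y) ⇒ ¬ (x ⇒ y)))

Connexive : ∀ {c} → Class c → BinOp c → Set (suc c)
Connexive V op = ProtoConnexive V op
  × Σ (FLe _) λ A → V A × ∃ λ x → ∃ λ y → op A x y ≢ op A y x

⇒∧-op : ∀ {c} → BinOp c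
⇒∧-op A = FLe._⇒∧_ A

⇒∘-op : ∀ {c} → BinOp c
⇒∘-op A = FLe._⇒∘_ A

{-# OPTIONS --safe #-}
-- In a Boolean algebra both connexive implications collapse to the biconditional
-- ¬ x ⊕ y, and x ⇒ ¬ y is the complement of x ⇒ y.  So x ⇒ ¬ x, ¬ x ⇒ x,
-- (x ⇒ y) · (x ⇒ ¬ y) and ¬ (x ⇒ ¬ y) · ¬ (x ⇒ y) all equal 0 there.  The Glivenko
-- property turns each Boolean identity t ≈ 0 into ¬ t ≈ ¬ 0 ≥ 1, i.e. t ≤ 0, in every
-- member of V ⊆ G, and residuation turns these four inequalities into Aristotle's and
-- Boethius' theses.  Non-symmetry is witnessed in the three-element Heyting chain
-- bot < mid < top, which lies in HA ⊆ V: there mid ⇒ top = top while top ⇒ mid = mid.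
module Submission where

open import Defs
open import Level using (Level)
open import Data.Nat using (ℕ; zero; suc)
open import Data.Product using (_×_; _,_)
open import Function.Bundles using (Equivalence; mk⇔; _⇔_)
open import Relation.Binary.PropositionalEquality
open import Algebra.Lattice.Bundles using (BooleanAlgebra)
import Algebra.Consequences.Propositional as Consequences
import Algebra.Lattice.Properties.BooleanAlgebra as BooleanAlgebraProperties

open Equivalence using (to; from)

module FLeProperties {c : Level} (A : FLe c) where
  open FLe A

  ∧-idem : ∀ x → x ∧ x ≡ x
  ∧-idem x = trans (cong (x ∧_) (sym (∨-absorbs-∧ x x))) (∧-absorbs-∨ x (x ∧ x))

  ≤-trans : ∀ {x y z} → x ≤ y → y ≤ z → x ≤ z
  ≤-trans {x} {y} {z} x≤y y≤z = begin
    x ∧ z        ≡⟨ cong (_∧ z) (sym x≤y) ⟩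
    (x ∧ y) ∧ z  ≡⟨ ∧-assoc x y z ⟩
    x ∧ (y ∧ z)  ≡⟨ cong (x ∧_) y≤z ⟩
    x ∧ y        ≡⟨ x≤y ⟩
    x            ∎
    where open ≡-Reasoning

  ·-monoˡ-≤ : ∀ {x y} z → x ≤ y → x · z ≤ y · z
  ·-monoˡ-≤ {x} {y} z x≤y =
    from (residuated x z (y · z)) (≤-trans x≤y (to (residuated y z (y · z)) (∧-idem (y · z))))

  ≤⇒𝟙≤↝ : ∀ {x y} → x ≤ y → 𝟙 ≤ x ↝ y
  ≤⇒𝟙≤↝ {x} {y} x≤y = to (residuated 𝟙 x y) (subst (_≤ y) (sym (·-identityˡ x)) x≤y)

  𝟙≤↝⇒≤ : ∀ {x y} → 𝟙 ≤ x ↝ y → x ≤ y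
  𝟙≤↝⇒≤ {x} {y} 𝟙≤x↝y = subst (_≤ y) (·-identityˡ x) (from (residuated 𝟙 x y) 𝟙≤x↝y)

  𝟙≤¬𝟘 : 𝟙 ≤ ¬ 𝟘
  𝟙≤¬𝟘 = ≤⇒𝟙≤↝ (∧-idem 𝟘)

  ·≤𝟘⇒≤¬ : ∀ {x y} → x · y ≤ 𝟘 → x ≤ ¬ y
  ·≤𝟘⇒≤¬ {x} {y} = to (residuated x y 𝟘)

  𝟙≤∧ : ∀ {x y} → 𝟙 ≤ x → 𝟙 ≤ y → 𝟙 ≤ x ∧ y
  𝟙≤∧ {x} {y} 𝟙≤x 𝟙≤y = trans (sym (∧-assoc 𝟙 x y)) (trans (cong (_∧ y) 𝟙≤x) 𝟙≤y)

  𝟙≤· : ∀ {x y} → 𝟙 ≤ x → 𝟙 ≤ y → 𝟙 ≤ x · y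
  𝟙≤· {x} {y} 𝟙≤x 𝟙≤y =
    ≤-trans 𝟙≤x (subst₂ _≤_ (·-identityˡ x) (·-comm y x) (·-monoˡ-≤ x 𝟙≤y))

data Conjunction : Set where
  meet fusion : Conjunction

module _ {c : Level} where

  conj : Conjunction → (A : FLe c) → FLe.Carrier A → FLe.Carrier A → FLe.Carrier A
  conj meet   A = FLe._∧_ A
  conj fusion A = FLe._·_ A

  connexive : Conjunction → BinOp c
  connexive k A x y = conj k A (x ↝ y) (y ↝ ¬ (¬ x))
    where open FLe A

conjₜ : Conjunction → Term → Term → Term
conjₜ meet   = _∧ₜ_
conjₜ fusion = _·ₜ_

connexiveₜ : Conjunction → Term → Term → Term
connexiveₜ k s t = conjₜ k (s ↝ₜ t) (t ↝ₜ (¬ₜ (¬ₜ s)))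

⟦connexiveₜ⟧ : ∀ {c} k (A : FLe c) s t ρ →
  ⟦ A ⟧ (connexiveₜ k s t) ρ ≡ connexive k A (⟦ A ⟧ s ρ) (⟦ A ⟧ t ρ)
⟦connexiveₜ⟧ meet   A s t ρ = refl
⟦connexiveₜ⟧ fusion A s t ρ = refl

𝟙≤conj : ∀ {c} k (A : FLe c) {x y} → let open FLe A in 𝟙 ≤ x → 𝟙 ≤ y → 𝟙 ≤ conj k A x y
𝟙≤conj meet   A = FLeProperties.𝟙≤∧ A
𝟙≤conj fusion A = FLeProperties.𝟙≤· A

𝟙≤⇒¬ : ∀ {c} k (A : FLe c) {u w} → let open FLe A in
  u · w ≤ 𝟘 → ¬ w · ¬ u ≤ 𝟘 → 𝟙 ≤ connexive k A u (¬ w)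
𝟙≤⇒¬ k A u·w≤𝟘 ¬w·¬u≤𝟘 = 𝟙≤conj k A (≤⇒𝟙≤↝ (·≤𝟘⇒≤¬ u·w≤𝟘)) (≤⇒𝟙≤↝ (·≤𝟘⇒≤¬ ¬w·¬u≤𝟘))
  where open FLeProperties A

X Y : Term
X = var 0
Y = var 1

⇒¬-selfₜ ¬⇒-selfₜ ⇒·⇒¬ₜ ¬⇒¬·¬⇒ₜ : Conjunction → Term
⇒¬-selfₜ  k = connexiveₜ k X (¬ₜ X)
¬⇒-selfₜ  k = connexiveₜ k (¬ₜ X) X
⇒·⇒¬ₜ    k = connexiveₜ k X Y ·ₜ connexiveₜ k X (¬ₜ Y)
¬⇒¬·¬⇒ₜ  k = (¬ₜ connexiveₜ k X (¬ₜ Y)) ·ₜ (¬ₜ connexiveₜ k X Y)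

module _ {c : Level} (k : Conjunction) (A : FLe c) (ρ : ℕ → FLe.Carrier A) where
  open FLe A

  ⟦⇒¬-selfₜ⟧ : ⟦ A ⟧ (⇒¬-selfₜ k) ρ ≡ connexive k A (ρ 0) (¬ ρ 0)
  ⟦⇒¬-selfₜ⟧ = ⟦connexiveₜ⟧ k A X (¬ₜ X) ρ

  ⟦¬⇒-selfₜ⟧ : ⟦ A ⟧ (¬⇒-selfₜ k) ρ ≡ connexive k A (¬ ρ 0) (ρ 0)
  ⟦¬⇒-selfₜ⟧ = ⟦connexiveₜ⟧ k A (¬ₜ X) X ρ

  ⟦⇒·⇒¬ₜ⟧ : ⟦ A ⟧ (⇒·⇒¬ₜ k) ρ ≡ connexive k A (ρ 0) (ρ 1) · connexive k A (ρ 0) (¬ ρ 1)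
  ⟦⇒·⇒¬ₜ⟧ = cong₂ _·_ (⟦connexiveₜ⟧ k A X Y ρ) (⟦connexiveₜ⟧ k A X (¬ₜ Y) ρ)

  ⟦¬⇒¬·¬⇒ₜ⟧ : ⟦ A ⟧ (¬⇒¬·¬⇒ₜ k) ρ ≡ ¬ connexive k A (ρ 0) (¬ ρ 1) · ¬ connexive k A (ρ 0) (ρ 1)
  ⟦¬⇒¬·¬⇒ₜ⟧ =
    cong₂ (λ u w → ¬ u · ¬ w) (⟦connexiveₜ⟧ k A X (¬ₜ Y) ρ) (⟦connexiveₜ⟧ k A X Y ρ)

booleanAlgebra : ∀ {c} (A : FLe c) → IsBA A → BooleanAlgebra c c
booleanAlgebra A (_ , _ , ∧-distribˡ-∨ , ∧-complementʳ , ∨-complementʳ , _ , _) = record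
  { _∨_ = _∨_ ; _∧_ = _∧_ ; ¬_ = ¬_ ; ⊤ = 𝟙 ; ⊥ = 𝟘
  ; isBooleanAlgebra = record
    { isDistributiveLattice = record
      { isLattice = record
        { isEquivalence = isEquivalence
        ; ∨-comm = ∨-comm ; ∨-assoc = ∨-assoc ; ∨-cong = cong₂ _∨_
        ; ∧-comm = ∧-comm ; ∧-assoc = ∧-assoc ; ∧-cong = cong₂ _∧_
        ; absorptive = ∨-absorbs-∧ , ∧-absorbs-∨
        }
      ; ∨-distrib-∧ = ∨-distribˡ-∧ , comm∧distrˡ⇒distrʳ ∨-comm ∨-distribˡ-∧
      ; ∧-distrib-∨ = ∧-distrib-∨
      }
    ; ∨-complement = (λ x → trans (∨-comm (¬ x) x) (∨-complementʳ x)) , ∨-complementʳ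
    ; ∧-complement = (λ x → trans (∧-comm (¬ x) x) (∧-complementʳ x)) , ∧-complementʳ
    ; ¬-cong = cong ¬_
    }
  }
  where
  open FLe A
  open Consequences using (comm∧distrˡ⇒distrʳ; distrib∧absorbs⇒distribˡ)
  open import Algebra.Definitions (_≡_ {A = Carrier}) using (_DistributesOver_; _DistributesOverˡ_)

  ∧-distrib-∨ : _∧_ DistributesOver _∨_
  ∧-distrib-∨ = ∧-distribˡ-∨ , comm∧distrˡ⇒distrʳ ∧-comm ∧-distribˡ-∨

  ∨-distribˡ-∧ : _∨_ DistributesOverˡ _∧_
  ∨-distribˡ-∧ =
    distrib∧absorbs⇒distribˡ (cong₂ _∨_) ∨-assoc ∧-comm ∨-absorbs-∧ ∧-absorbs-∨ ∧-distrib-∨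

module BooleanFLe {c : Level} {A : FLe c} (isBA : IsBA A) where
  open FLe A
  open BooleanAlgebraProperties (booleanAlgebra A isBA)
    using (¬-involutive; deMorgan₁; _⊕_; module DefaultXorRing)
  open DefaultXorRing using (⊕-inverseˡ; ¬-distribʳ-⊕)

  private
    ·≡∧ : ∀ x y → x · y ≡ x ∧ y
    ·≡∧ = let (_ , _ , _ , _ , _ , ·≡∧ , _) = isBA in ·≡∧

    ↝≡¬∨ : ∀ x y → x ↝ y ≡ ¬ x ∨ y
    ↝≡¬∨ = let (_ , _ , _ , _ , _ , _ , ↝≡¬∨) = isBA in ↝≡¬∨

    ∧-complementʳ : ∀ x → x ∧ ¬ x ≡ 𝟘
    ∧-complementʳ = let (_ , _ , _ , ∧-complementʳ , _) = isBA in ∧-complementʳ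

  conj≡∧ : ∀ k x y → conj k A x y ≡ x ∧ y
  conj≡∧ meet   x y = refl
  conj≡∧ fusion x y = ·≡∧ x y

  connexive≡¬⊕ : ∀ k x y → connexive k A x y ≡ ¬ x ⊕ y
  connexive≡¬⊕ k x y = begin
    conj k A (x ↝ y) (y ↝ ¬ (¬ x))      ≡⟨ conj≡∧ k _ _ ⟩
    (x ↝ y) ∧ (y ↝ ¬ (¬ x))             ≡⟨ cong₂ _∧_ (↝≡¬∨ x y) (↝≡¬∨ y (¬ (¬ x))) ⟩
    (¬ x ∨ y) ∧ (¬ y ∨ ¬ (¬ x))         ≡⟨ cong ((¬ x ∨ y) ∧_) (trans (∨-comm _ _) (sym (deMorgan₁ _ _))) ⟩
    (¬ x ∨ y) ∧ ¬ (¬ x ∧ y)             ∎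
    where open ≡-Reasoning

  connexive-¬ʳ : ∀ k x y → connexive k A x (¬ y) ≡ ¬ (connexive k A x y)
  connexive-¬ʳ k x y = begin
    connexive k A x (¬ y)    ≡⟨ connexive≡¬⊕ k x (¬ y) ⟩
    ¬ x ⊕ ¬ y                ≡⟨ ¬-distribʳ-⊕ (¬ x) y ⟨
    ¬ (¬ x ⊕ y)              ≡⟨ cong ¬_ (connexive≡¬⊕ k x y) ⟨
    ¬ (connexive k A x y)    ∎
    where open ≡-Reasoning

  module _ (k : Conjunction) where
    infix 6 _⇒_
    _⇒_ : Carrier → Carrier → Carrier
    _⇒_ = connexive k A

    ⇒¬-self≡𝟘 : ∀ x → x ⇒ ¬ x ≡ 𝟘
    ⇒¬-self≡𝟘 x = trans (connexive≡¬⊕ k x (¬ x)) (⊕-inverseˡ (¬ x))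

    ¬⇒-self≡𝟘 : ∀ x → ¬ x ⇒ x ≡ 𝟘
    ¬⇒-self≡𝟘 x = begin
      ¬ x ⇒ x      ≡⟨ connexive≡¬⊕ k (¬ x) x ⟩
      ¬ (¬ x) ⊕ x  ≡⟨ cong (_⊕ x) (¬-involutive x) ⟩
      x ⊕ x        ≡⟨ ⊕-inverseˡ x ⟩
      𝟘            ∎
      where open ≡-Reasoning

    ⇒·⇒¬≡𝟘 : ∀ x y → (x ⇒ y) · (x ⇒ ¬ y) ≡ 𝟘
    ⇒·⇒¬≡𝟘 x y = begin
      (x ⇒ y) · (x ⇒ ¬ y)  ≡⟨ ·≡∧ _ _ ⟩
      (x ⇒ y) ∧ (x ⇒ ¬ y)  ≡⟨ cong ((x ⇒ y) ∧_) (connexive-¬ʳ k x y) ⟩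
      (x ⇒ y) ∧ ¬ (x ⇒ y)  ≡⟨ ∧-complementʳ _ ⟩
      𝟘                    ∎
      where open ≡-Reasoning

    ¬⇒¬·¬⇒≡𝟘 : ∀ x y → ¬ (x ⇒ ¬ y) · ¬ (x ⇒ y) ≡ 𝟘
    ¬⇒¬·¬⇒≡𝟘 x y = begin
      ¬ (x ⇒ ¬ y) · ¬ (x ⇒ y)    ≡⟨ ·≡∧ _ _ ⟩
      ¬ (x ⇒ ¬ y) ∧ ¬ (x ⇒ y)    ≡⟨ cong (λ u → ¬ u ∧ ¬ (x ⇒ y)) (connexive-¬ʳ k x y) ⟩
      ¬ (¬ (x ⇒ y)) ∧ ¬ (x ⇒ y)  ≡⟨ ∧-comm _ _ ⟩
      ¬ (x ⇒ y) ∧ ¬ (¬ (x ⇒ y))  ≡⟨ ∧-complementʳ _ ⟩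
      𝟘                          ∎
      where open ≡-Reasoning

  ⇒¬-self≈𝟘 : ∀ k → A ⊨ (⇒¬-selfₜ k , 0ₜ)
  ⇒¬-self≈𝟘 k ρ = trans (⟦⇒¬-selfₜ⟧ k A ρ) (⇒¬-self≡𝟘 k (ρ 0))

  ¬⇒-self≈𝟘 : ∀ k → A ⊨ (¬⇒-selfₜ k , 0ₜ)
  ¬⇒-self≈𝟘 k ρ = trans (⟦¬⇒-selfₜ⟧ k A ρ) (¬⇒-self≡𝟘 k (ρ 0))

  ⇒·⇒¬≈𝟘 : ∀ k → A ⊨ (⇒·⇒¬ₜ k , 0ₜ)
  ⇒·⇒¬≈𝟘 k ρ = trans (⟦⇒·⇒¬ₜ⟧ k A ρ) (⇒·⇒¬≡𝟘 k (ρ 0) (ρ 1))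

  ¬⇒¬·¬⇒≈𝟘 : ∀ k → A ⊨ (¬⇒¬·¬⇒ₜ k , 0ₜ)
  ¬⇒¬·¬⇒≈𝟘 k ρ = trans (⟦¬⇒¬·¬⇒ₜ⟧ k A ρ) (¬⇒¬·¬⇒≡𝟘 k (ρ 0) (ρ 1))

glivenko-≤𝟘 : ∀ {c} {W : Class c} → GlivenkoBA W → ∀ {A} → W A →
  ∀ t → IsBA ⊨ᶜ (t , 0ₜ) → ∀ ρ → FLe._≤_ A (⟦ A ⟧ t ρ) (FLe.𝟘 A)
glivenko-≤𝟘 glivenko {A} W-A t BA⊨t≈0 ρ =
  𝟙≤↝⇒≤ (subst (𝟙 ≤_) (sym (to (glivenko t 0ₜ) BA⊨t≈0 A W-A ρ)) 𝟙≤¬𝟘)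
  where open FLe A
        open FLeProperties A

protoConnexive : ∀ {c} {W : Class c} → GlivenkoBA W → ∀ k → ProtoConnexive W (connexive k)
protoConnexive glivenko k A W-A x y =
    ≤⇒𝟙≤↝ (≤𝟘 (⇒¬-selfₜ k) (⟦⇒¬-selfₜ⟧ k A ρ) (λ _ isBA → BooleanFLe.⇒¬-self≈𝟘 isBA k))
  , ≤⇒𝟙≤↝ (≤𝟘 (¬⇒-selfₜ k) (⟦¬⇒-selfₜ⟧ k A ρ) (λ _ isBA → BooleanFLe.¬⇒-self≈𝟘 isBA k))
  , 𝟙≤⇒¬ k A ⇒·⇒¬≤𝟘 ¬⇒¬·¬⇒≤𝟘
  , 𝟙≤⇒¬ k A (swap ⇒·⇒¬≤𝟘) (swap ¬⇒¬·¬⇒≤𝟘)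
  where
  open FLe A
  open FLeProperties A

  infix 6 _⇒_
  _⇒_ : Carrier → Carrier → Carrier
  _⇒_ = connexive k A

  ρ : ℕ → Carrier
  ρ zero    = x
  ρ (suc _) = y

  ≤𝟘 : ∀ t {a} → ⟦ A ⟧ t ρ ≡ a → IsBA ⊨ᶜ (t , 0ₜ) → a ≤ 𝟘
  ≤𝟘 t refl BA⊨t≈0 = glivenko-≤𝟘 glivenko W-A t BA⊨t≈0 ρ

  swap : ∀ {u w} → u · w ≤ 𝟘 → w · u ≤ 𝟘
  swap {u} {w} = subst (_≤ 𝟘) (·-comm u w)

  ⇒·⇒¬≤𝟘 : (x ⇒ y) · (x ⇒ ¬ y) ≤ 𝟘
  ⇒·⇒¬≤𝟘 = ≤𝟘 (⇒·⇒¬ₜ k) (⟦⇒·⇒¬ₜ⟧ k A ρ) (λ _ isBA → BooleanFLe.⇒·⇒¬≈𝟘 isBA k)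

  ¬⇒¬·¬⇒≤𝟘 : ¬ (x ⇒ ¬ y) · ¬ (x ⇒ y) ≤ 𝟘
  ¬⇒¬·¬⇒≤𝟘 = ≤𝟘 (¬⇒¬·¬⇒ₜ k) (⟦¬⇒¬·¬⇒ₜ⟧ k A ρ) (λ _ isBA → BooleanFLe.¬⇒¬·¬⇒≈𝟘 isBA k)

data Three {c : Level} : Set c where
  bot mid top : Three

module _ {c : Level} where
  infixr 6 _⊓_ _⊔_
  infixr 5 _⇾_

  _⊓_ _⊔_ _⇾_ : Three {c} → Three {c} → Three {c}
  bot ⊓ _   = bot
  top ⊓ y   = y
  mid ⊓ bot = bot
  mid ⊓ _   = mid

  bot ⊔ y   = y
  top ⊔ _   = top
  mid ⊔ top = top
  mid ⊔ _   = mid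

  bot ⇾ _   = top
  top ⇾ y   = y
  mid ⇾ bot = bot
  mid ⇾ _   = top

  ⊓-comm : ∀ x y → x ⊓ y ≡ y ⊓ x
  ⊓-comm bot bot = refl
  ⊓-comm bot mid = refl
  ⊓-comm bot top = refl
  ⊓-comm mid bot = refl
  ⊓-comm mid mid = refl
  ⊓-comm mid top = refl
  ⊓-comm top bot = refl
  ⊓-comm top mid = refl
  ⊓-comm top top = refl

  ⊔-comm : ∀ x y → x ⊔ y ≡ y ⊔ x
  ⊔-comm bot bot = refl
  ⊔-comm bot mid = refl
  ⊔-comm bot top = refl
  ⊔-comm mid bot = refl
  ⊔-comm mid mid = refl
  ⊔-comm mid top = refl
  ⊔-comm top bot = refl
  ⊔-comm top mid = refl
  ⊔-comm top top = refl

  ⊓-assoc : ∀ x y z → (x ⊓ y) ⊓ z ≡ x ⊓ (y ⊓ z)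
  ⊓-assoc bot _   _   = refl
  ⊓-assoc top _   _   = refl
  ⊓-assoc mid bot _   = refl
  ⊓-assoc mid mid bot = refl
  ⊓-assoc mid mid mid = refl
  ⊓-assoc mid mid top = refl
  ⊓-assoc mid top _   = refl

  ⊔-assoc : ∀ x y z → (x ⊔ y) ⊔ z ≡ x ⊔ (y ⊔ z)
  ⊔-assoc bot _   _   = refl
  ⊔-assoc top _   _   = refl
  ⊔-assoc mid bot _   = refl
  ⊔-assoc mid mid bot = refl
  ⊔-assoc mid mid mid = refl
  ⊔-assoc mid mid top = refl
  ⊔-assoc mid top _   = refl

  ⊓-absorbs-⊔ : ∀ x y → x ⊓ (x ⊔ y) ≡ x
  ⊓-absorbs-⊔ bot _   = refl
  ⊓-absorbs-⊔ top _   = refl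
  ⊓-absorbs-⊔ mid bot = refl
  ⊓-absorbs-⊔ mid mid = refl
  ⊓-absorbs-⊔ mid top = refl

  ⊔-absorbs-⊓ : ∀ x y → x ⊔ (x ⊓ y) ≡ x
  ⊔-absorbs-⊓ bot _   = refl
  ⊔-absorbs-⊓ top _   = refl
  ⊔-absorbs-⊓ mid bot = refl
  ⊔-absorbs-⊓ mid mid = refl
  ⊔-absorbs-⊓ mid top = refl

  ⊓-identityˡ : ∀ x → top ⊓ x ≡ x
  ⊓-identityˡ _ = refl

  ⊓-⇾-residuated : ∀ x y z → ((x ⊓ y) ⊓ z ≡ x ⊓ y) ⇔ (x ⊓ (y ⇾ z) ≡ x)
  ⊓-⇾-residuated bot _   _   = mk⇔ (λ _ → refl) (λ _ → refl)
  ⊓-⇾-residuated mid bot _   = mk⇔ (λ _ → refl) (λ _ → refl)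
  ⊓-⇾-residuated mid mid bot = mk⇔ (λ ()) (λ ())
  ⊓-⇾-residuated mid mid mid = mk⇔ (λ _ → refl) (λ _ → refl)
  ⊓-⇾-residuated mid mid top = mk⇔ (λ _ → refl) (λ _ → refl)
  ⊓-⇾-residuated mid top bot = mk⇔ (λ ()) (λ ())
  ⊓-⇾-residuated mid top mid = mk⇔ (λ _ → refl) (λ _ → refl)
  ⊓-⇾-residuated mid top top = mk⇔ (λ _ → refl) (λ _ → refl)
  ⊓-⇾-residuated top bot _   = mk⇔ (λ _ → refl) (λ _ → refl)
  ⊓-⇾-residuated top mid bot = mk⇔ (λ ()) (λ ())
  ⊓-⇾-residuated top mid mid = mk⇔ (λ _ → refl) (λ _ → refl)
  ⊓-⇾-residuated top mid top = mk⇔ (λ _ → refl) (λ _ → refl)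
  ⊓-⇾-residuated top top bot = mk⇔ (λ ()) (λ ())
  ⊓-⇾-residuated top top mid = mk⇔ (λ ()) (λ ())
  ⊓-⇾-residuated top top top = mk⇔ (λ _ → refl) (λ _ → refl)

  three : FLe c
  three = record
    { Carrier = Three ; _∧_ = _⊓_ ; _∨_ = _⊔_ ; _·_ = _⊓_ ; _↝_ = _⇾_ ; 𝟘 = bot ; 𝟙 = top
    ; ∧-comm = ⊓-comm ; ∨-comm = ⊔-comm ; ∧-assoc = ⊓-assoc ; ∨-assoc = ⊔-assoc
    ; ∧-absorbs-∨ = ⊓-absorbs-⊔ ; ∨-absorbs-∧ = ⊔-absorbs-⊓
    ; ·-comm = ⊓-comm ; ·-assoc = ⊓-assoc ; ·-identityˡ = ⊓-identityˡ
    ; residuated = ⊓-⇾-residuated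
    }

  three-isHA : IsHA three
  three-isHA = ⊓-topʳ , (λ _ → refl) , (λ _ _ → refl)
    where
    ⊓-topʳ : ∀ x → x ⊓ top ≡ x
    ⊓-topʳ bot = refl
    ⊓-topʳ mid = refl
    ⊓-topʳ top = refl

  connexive-not-symmetric : ∀ k → connexive k three mid top ≢ connexive k three top mid
  connexive-not-symmetric meet   ()
  connexive-not-symmetric fusion ()

corollary3p22 : ∀ {c : Level} (V G : Class c) → IsVariety V → IsGlivenkoVarietyBA G
    → IsHA ⊆ V → V ⊆ G → Connexive V ⇒∧-op × Connexive V ⇒∘-op
corollary3p22 V G _ (_ , glivenko , _) HA⊆V V⊆G = connexive-in-V meet , connexive-in-V fusion
  where
  connexive-in-V : ∀ k → Connexive V (connexive k)
  connexive-in-V k =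
      (λ A V-A → protoConnexive glivenko k A (V⊆G A V-A))
    , three , HA⊆V three three-isHA , mid , top , connexive-not-symmetric k
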